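{- Let $T$ be a full binary tree of height $h$ rooted at $r$, let $C$ be the set of leaves of $T$, and let $k=h$. Consider the firefighting game on $T$ with the fire starting at $r$ and firefighters placed according to a valid $k$-step strategy. If more than one vertex at the same depth $d\le h$ is protected by firefighters, then more than one leaf of $T$ burns.
   Context: Firefighting game on a graph with source $r$: at time $0$ the fire breaks out at $r$; at each odd time step $2i-1$ ($1\le i\le k$) one firefighter is placed on a vertex not already burning, which becomes permanently protected; at each even time step the fire spreads from every burning vertex to all unprotected neighbours. A $k$-step strategy $\mathfrak{h}:\{1,\dots,k\}\to V(T)$ specifies the vertex $\mathfrak{h}(i)$ protected at step $2i-1$, and it is valid if each $\mathfrak{h}(i)$ is not burning when it is placed. A full binary tree of height $h$ has $2^d$ vertices at depth $d$ for each $0\le d\le h$, the leaves being exactly the vertices at depth $h$. -}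

module Defs where

open import Data.Nat using (ℕ; zero; suc; _<_)
open import Data.Fin using (Fin; toℕ)
open import Data.Product using (Σ; _×_)
open import Data.Sum using (_⊎_)
open import Relation.Binary.PropositionalEquality using (_≡_)
open import Relation.Nullary using (¬_)

-- Vertices of the full binary tree of height h.
-- A vertex is either the root of the tree, or a vertex of the left
-- (resp. right) subtree of the root, itself a full binary tree of height h-1.
data Node : ℕ → Set where
  root  : ∀ {h} → Node h
  left  : ∀ {h} → Node h → Node (suc h)
  right : ∀ {h} → Node h → Node (suc h)

depth : ∀ {h} → Node h → ℕ
depth root      = 0
depth (left v)  = suc (depth v)
depth (right v) = suc (depth v)

IsLeaf : ∀ {h} → Node h → Set
IsLeaf {h} v = depth v ≡ h

data Child : ∀ {h} → Node h → Node h → Set where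
  root-left   : ∀ {h} → Child {suc h} root (left root)
  root-right  : ∀ {h} → Child {suc h} root (right root)
  left-child  : ∀ {h} {u v : Node h} → Child u v → Child (left u) (left v)
  right-child : ∀ {h} {u v : Node h} → Child u v → Child (right u) (right v)

Adj : ∀ {h} → Node h → Node h → Set
Adj u v = Child u v ⊎ Child v u

-- A k-step strategy: firefighter number i (0-indexed, i.e. the paper's
-- step i+1) is placed on vertex s i at time 2i+1.
Strategy : ℕ → ℕ → Set
Strategy h k = Fin k → Node h

-- Protected s m v : v carries one of the first m firefighters
-- (those placed at times 1,3,...,2m-1).
Protected : ∀ {h k} → Strategy h k → ℕ → Node h → Set
Protected {k = k} s m v = Σ (Fin k) (λ i → (toℕ i < m) × (s i ≡ v))

-- Burns s t v : v is burning after t spreading steps, i.e. at times 2t and 2t+1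
-- (fire starts at the root at time 0; the t-th spread happens at time 2t,
-- after the firefighters placed at times 1,...,2t-1).
data Burns {h k : ℕ} (s : Strategy h k) : ℕ → Node h → Set where
  start  : Burns s 0 root
  stay   : ∀ {t v} → Burns s t v → Burns s (suc t) v
  spread : ∀ {t u v} → Burns s t u → Adj u v → ¬ Protected s (suc t) v →
           Burns s (suc t) v

-- validity: the firefighter placed at time 2i+1 goes on a vertex that is
-- not burning at that time (i.e. after i spreads)
Valid : ∀ {h k} → Strategy h k → Set
Valid s = ∀ i → ¬ Burns s (toℕ i) (s i)

Burnt : ∀ {h k} → Strategy h k → Node h → Set
Burnt s v = Σ ℕ (λ t → Burns s t v)

module Submission where

-- The firefighters can only save the leaves lying below the vertices they
-- protect in time, and a full binary tree of height h has few leaves below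
-- deep vertices; the theorem is a counting (Kraft-inequality) argument.
--
--  * Firefighter i (placed at time 2i+1) is *useful* only if the depth of
--    its vertex exceeds i; otherwise the fire reaches that depth before the
--    protection matters.  A vertex of depth d has 2^(h-d) leaves below it
--    (its weight), so useful firefighter i saves at most 2^(h-i-1) leaves.
--  * Every vertex not below a useful firefighter burns at time equal to its
--    depth (induction along the path from the root).
--  * Counting: if the protected vertices have total weight below 2^h - 1,
--    two distinct leaves avoid all of them (split at the root, recurse).
--  * Kraft bound: the weights saved sum to at most 2^h - 1, and to at most
--    2^h - 2 as soon as one firefighter i is not placed at depth exactly
--    i+1.  Two firefighters at the same depth cannot both be so placed.

open import Defs
open import Data.Nat using (ℕ; zero; suc; _+_; _*_; _^_; _≤_; _<_; z≤n; s≤s; _<?_; _≟_)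
open import Data.Nat.Properties
open import Algebra.Properties.CommutativeSemigroup +-commutativeSemigroup using (x∙yz≈y∙xz)
open import Data.Fin using (Fin; toℕ) renaming (zero to fzero; suc to fsuc)
open import Data.Fin.Properties using (toℕ<n; toℕ-injective)
open import Data.Product using (Σ; _×_; _,_)
open import Data.Sum using (inj₁)
open import Data.List using (List; []; _∷_; map; tabulate; catMaybes)
open import Data.Nat.ListAction using (sum)
open import Data.List.Properties using (map-tabulate)
open import Data.List.Relation.Unary.All as All using (All; []; _∷_)
open import Data.List.Relation.Unary.All.Properties using (tabulate⁻)
open import Data.Maybe using (Maybe; just; nothing; maybe)
import Data.Maybe.Relation.Unary.All as Maybe
open import Data.Empty using (⊥-elim)
open import Relation.Nullary using (¬_; yes; no)
open import Relation.Binary.PropositionalEquality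
  using (_≡_; _≢_; refl; sym; trans; cong; subst; subst₂; module ≡-Reasoning)

double : ∀ c → 2 * c ≡ c + c
double c = cong (c +_) (+-identityʳ c)

*-double : ∀ a b → a * (2 * b) ≡ 2 * (a * b)
*-double a b = begin
  a * (2 * b)   ≡⟨ sym (*-assoc a 2 b) ⟩
  (a * 2) * b   ≡⟨ cong (_* b) (*-comm a 2) ⟩
  (2 * a) * b   ≡⟨ *-assoc 2 a b ⟩
  2 * (a * b)   ∎
  where open ≡-Reasoning

halve : ∀ a b c → a * (2 * b) ≤ 2 * c → a * b ≤ c
halve a b c p = *-cancelˡ-≤ 2 (subst (_≤ 2 * c) (*-double a b) p)

other-half : ∀ {l r c} → l + r < c + c → ¬ l < c → r < c
other-half {l} {r} {c} lr<cc l≮c =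
  +-cancelˡ-< c r c (≤-<-trans (+-monoˡ-≤ r (≮⇒≥ l≮c)) lr<cc)

KraftBound : ∀ n → (Fin n → ℕ) → Set
KraftBound n x = ∀ k → x k * 2 ^ suc (toℕ k) ≤ 2 ^ n

kraft-head : ∀ n (x : Fin (suc n) → ℕ) → KraftBound (suc n) x → x fzero ≤ 2 ^ n
kraft-head n x bound =
  subst (_≤ 2 ^ n) (*-identityʳ (x fzero)) (halve (x fzero) 1 (2 ^ n) (bound fzero))

kraft-tail : ∀ n (x : Fin (suc n) → ℕ) → KraftBound (suc n) x →
            KraftBound n (λ k → x (fsuc k))
kraft-tail n x bound k = halve (x (fsuc k)) (2 ^ suc (toℕ k)) (2 ^ n) (bound (fsuc k))

kraft : ∀ n (x : Fin n → ℕ) → KraftBound n x → sum (tabulate x) < 2 ^ n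
kraft zero    x bound = s≤s z≤n
kraft (suc n) x bound = subst (sum (tabulate x) <_) (sym (double (2 ^ n)))
  (+-mono-≤-< (kraft-head n x bound) (kraft n (λ k → x (fsuc k)) (kraft-tail n x bound)))

kraft-strict : ∀ n (x : Fin n → ℕ) → KraftBound n x →
              ∀ a → suc (x a) * 2 ^ suc (toℕ a) ≤ 2 ^ n →
              suc (sum (tabulate x)) < 2 ^ n
kraft-strict (suc n) x bound fzero slack =
  subst (suc (sum (tabulate x)) <_) (sym (double (2 ^ n)))
    (+-mono-≤-< (subst (_≤ 2 ^ n) (*-identityʳ (suc (x fzero)))
                  (halve (suc (x fzero)) 1 (2 ^ n) slack))
                (kraft n (λ k → x (fsuc k)) (kraft-tail n x bound)))
kraft-strict (suc n) x bound (fsuc a) slack =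
  subst₂ _<_ (+-suc (x fzero) (sum (tabulate (λ k → x (fsuc k))))) (sym (double (2 ^ n)))
    (+-mono-≤-< (kraft-head n x bound)
                (kraft-strict n (λ k → x (fsuc k)) (kraft-tail n x bound) a
                   (halve (suc (x (fsuc a))) (2 ^ suc (toℕ a)) (2 ^ n) slack)))

-- The weight of a vertex of depth d is 2^(h-d), the number of leaves below it.
wt : ∀ {h} → Node h → ℕ
wt {h} root = 2 ^ h
wt (left v)  = wt v
wt (right v) = wt v

wt-depth : ∀ {h} (v : Node h) → wt v * 2 ^ depth v ≡ 2 ^ h
wt-depth {h} root = *-identityʳ (2 ^ h)
wt-depth (left v)  = trans (*-double (wt v) (2 ^ depth v)) (cong (2 *_) (wt-depth v))
wt-depth (right v) = trans (*-double (wt v) (2 ^ depth v)) (cong (2 *_) (wt-depth v))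

wt-positive : ∀ {h} (v : Node h) → 1 ≤ wt v
wt-positive {h} root = m^n>0 2 h
wt-positive (left v)  = wt-positive v
wt-positive (right v) = wt-positive v

wt-leaf : ∀ {h} (v : Node h) → IsLeaf v → wt v ≡ 1
wt-leaf root      refl = refl
wt-leaf (left v)  e    = wt-leaf v (suc-injective e)
wt-leaf (right v) e    = wt-leaf v (suc-injective e)

weight : ∀ {h} → List (Node h) → ℕ
weight B = sum (map wt B)

data _⊑_ : ∀ {h} → Node h → Node h → Set where
  root⊑  : ∀ {h} {v : Node h} → root ⊑ v
  left⊑  : ∀ {h} {a b : Node h} → a ⊑ b → left a ⊑ left b
  right⊑ : ∀ {h} {a b : Node h} → a ⊑ b → right a ⊑ right b

⊑-refl : ∀ {h} (v : Node h) → v ⊑ v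
⊑-refl root      = root⊑
⊑-refl (left v)  = left⊑ (⊑-refl v)
⊑-refl (right v) = right⊑ (⊑-refl v)

⊑-trans : ∀ {h} {a b c : Node h} → a ⊑ b → b ⊑ c → a ⊑ c
⊑-trans root⊑      _          = root⊑
⊑-trans (left⊑ p)  (left⊑ q)  = left⊑ (⊑-trans p q)
⊑-trans (right⊑ p) (right⊑ q) = right⊑ (⊑-trans p q)

Free : ∀ {h} → List (Node h) → Node h → Set
Free B ℓ = All (λ w → ¬ w ⊑ ℓ) B

lefts : ∀ {h} → List (Node (suc h)) → List (Node h)
lefts []            = []
lefts (left a ∷ B)  = a ∷ lefts B
lefts (_ ∷ B)       = lefts B

rights : ∀ {h} → List (Node (suc h)) → List (Node h)
rights []            = []
rights (right a ∷ B) = a ∷ rights B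
rights (_ ∷ B)       = rights B

split-weight : ∀ {h} (B : List (Node (suc h))) →
               weight (lefts B) + weight (rights B) ≤ weight B
split-weight [] = z≤n
split-weight {h} (root ∷ B) = ≤-trans (split-weight B) (m≤n+m (weight B) (2 ^ suc h))
split-weight (left a ∷ B) =
  subst (_≤ wt a + weight B) (sym (+-assoc (wt a) (weight (lefts B)) (weight (rights B))))
        (+-monoʳ-≤ (wt a) (split-weight B))
split-weight (right a ∷ B) =
  subst (_≤ wt a + weight B) (x∙yz≈y∙xz (wt a) (weight (lefts B)) (weight (rights B)))
        (+-monoʳ-≤ (wt a) (split-weight B))

avoids-root : ∀ {h} (B : List (Node h)) → weight B < 2 ^ h → All (_≢ root) B
avoids-root [] _ = []
avoids-root {h} (v ∷ B) lt =
  (λ { refl → <-irrefl refl (≤-<-trans (m≤m+n (2 ^ h) (weight B)) lt) }) ∷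
  avoids-root B (≤-<-trans (m≤n+m (weight B) (wt v)) lt)

free-left : ∀ {h} {ℓ : Node h} (B : List (Node (suc h))) → All (_≢ root) B →
            Free (lefts B) ℓ → Free B (left ℓ)
free-left [] _ _ = []
free-left (root ∷ B) (r≢r ∷ _) _ = ⊥-elim (r≢r refl)
free-left (left a ∷ B) (_ ∷ nr) (a⋢ℓ ∷ fr) = (λ { (left⊑ p) → a⋢ℓ p }) ∷ free-left B nr fr
free-left (right a ∷ B) (_ ∷ nr) fr = (λ ()) ∷ free-left B nr fr

free-right : ∀ {h} {ℓ : Node h} (B : List (Node (suc h))) → All (_≢ root) B →
             Free (rights B) ℓ → Free B (right ℓ)
free-right [] _ _ = []
free-right (root ∷ B) (r≢r ∷ _) _ = ⊥-elim (r≢r refl)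
free-right (left a ∷ B) (_ ∷ nr) fr = (λ ()) ∷ free-right B nr fr
free-right (right a ∷ B) (_ ∷ nr) (a⋢ℓ ∷ fr) = (λ { (right⊑ p) → a⋢ℓ p }) ∷ free-right B nr fr

free-leaf : ∀ h (B : List (Node h)) → weight B < 2 ^ h →
            Σ (Node h) λ ℓ → IsLeaf ℓ × Free B ℓ
free-leaf zero [] _ = root , refl , []
free-leaf zero (root ∷ B) (s≤s ())
free-leaf (suc h) B lt with weight (lefts B) <? 2 ^ h
... | yes lt-left with free-leaf h (lefts B) lt-left
...   | ℓ , leaf , fr = left ℓ , cong suc leaf , free-left B (avoids-root B lt) fr
free-leaf (suc h) B lt | no ≮-left with free-leaf h (rights B) lt-right
  where
  lt-right : weight (rights B) < 2 ^ h
  lt-right = other-half (≤-<-trans (split-weight B) (subst (weight B <_) (double (2 ^ h)) lt)) ≮-left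
... | ℓ , leaf , fr = right ℓ , cong suc leaf , free-right B (avoids-root B lt) fr

-- With one more unit of room, a second free leaf exists: block the first
-- leaf (of weight 1) and count again.
two-free-leaves : ∀ h (B : List (Node h)) → suc (weight B) < 2 ^ h →
                  Σ (Node h) λ a → Σ (Node h) λ b →
                    a ≢ b × IsLeaf a × IsLeaf b × Free B a × Free B b
two-free-leaves h B lt with free-leaf h B (<-trans (n<1+n (weight B)) lt)
... | a , leaf-a , free-a
  with free-leaf h (a ∷ B) (subst (λ w → w + weight B < 2 ^ h) (sym (wt-leaf a leaf-a)) lt)
...   | b , leaf-b , a⋢b ∷ free-b =
  a , b , (λ { refl → a⋢b (⊑-refl a) }) , leaf-a , leaf-b , free-a , free-b

Parent : ∀ {h} → ℕ → Node h → Set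
Parent {h} n v = Σ (Node h) λ p → Child p v × depth p ≡ n × p ⊑ v

parent-in-left : ∀ {h n} {v : Node h} → Parent n v → Parent (suc n) (left v)
parent-in-left (p , c , d , a) = left p , left-child c , cong suc d , left⊑ a

parent-in-right : ∀ {h n} {v : Node h} → Parent n v → Parent (suc n) (right v)
parent-in-right (p , c , d , a) = right p , right-child c , cong suc d , right⊑ a

parent : ∀ {h n} (v : Node h) → depth v ≡ suc n → Parent n v
parent (left root)          refl = root , root-left , refl , root⊑
parent (left v@(left _))    refl = parent-in-left (parent v refl)
parent (left v@(right _))   refl = parent-in-left (parent v refl)
parent (right root)         refl = root , root-right , refl , root⊑
parent (right v@(left _))   refl = parent-in-right (parent v refl)
parent (right v@(right _))  refl = parent-in-right (parent v refl)

-- Firefighter i is useful when its vertex lies deeper than i, i.e. the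
-- protection is in place before the fire can reach that depth.
useful : ∀ {h k} → Strategy h k → Fin k → Maybe (Node h)
useful s i with toℕ i <? depth (s i)
... | yes _ = just (s i)
... | no _  = nothing

effective : ∀ {h k} → Strategy h k → List (Node h)
effective s = catMaybes (tabulate (useful s))

saved : ∀ {h k} → Strategy h k → Fin k → ℕ
saved s i = maybe wt 0 (useful s i)

All-catMaybes⁻ : ∀ {A : Set} {P : A → Set} (xs : List (Maybe A)) →
                 All P (catMaybes xs) → All (Maybe.All P) xs
All-catMaybes⁻ [] [] = []
All-catMaybes⁻ (just x ∷ xs) (px ∷ pxs) = Maybe.just px ∷ All-catMaybes⁻ xs pxs
All-catMaybes⁻ (nothing ∷ xs) pxs = Maybe.nothing ∷ All-catMaybes⁻ xs pxs

weight-catMaybes : ∀ {h} (xs : List (Maybe (Node h))) →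
                   weight (catMaybes xs) ≡ sum (map (maybe wt 0) xs)
weight-catMaybes [] = refl
weight-catMaybes (just v ∷ xs)  = cong (wt v +_) (weight-catMaybes xs)
weight-catMaybes (nothing ∷ xs) = weight-catMaybes xs

weight-effective : ∀ {h k} (s : Strategy h k) → weight (effective s) ≡ sum (tabulate (saved s))
weight-effective s =
  trans (weight-catMaybes (tabulate (useful s))) (cong sum (map-tabulate (useful s) (maybe wt 0)))

free-effective : ∀ {h k} (s : Strategy h k) {v : Node h} → Free (effective s) v →
                 ∀ i → toℕ i < depth (s i) → ¬ s i ⊑ v
free-effective s fr i i<d with toℕ i <? depth (s i)
    | tabulate⁻ (All-catMaybes⁻ (tabulate (useful s)) fr) i
... | yes _   | Maybe.just si⋢v = si⋢v
... | no i≮d  | _               = ⊥-elim (i≮d i<d)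

-- Induction along the path from the root;
-- a firefighter protecting v in time would be useful.
burns-at-depth : ∀ {h k} (s : Strategy h k) n (v : Node h) → depth v ≡ n →
                 Free (effective s) v → Burns s n v
burns-at-depth s zero root refl _ = start
burns-at-depth s (suc n) v d≡ fr with parent v d≡
... | p , p→v , dp≡ , p⊑v =
  spread (burns-at-depth s n p dp≡ (All.map (λ w⋢v w⊑p → w⋢v (⊑-trans w⊑p p⊑v)) fr))
         (inj₁ p→v) unprotected
  where
  unprotected : ¬ Protected s (suc n) v
  unprotected (i , i<n , refl) =
    free-effective s fr i (subst (toℕ i <_) (sym d≡) i<n) (⊑-refl (s i))

saved-bound : ∀ {h k} (s : Strategy h k) i → saved s i * 2 ^ suc (toℕ i) ≤ 2 ^ h
saved-bound s i with toℕ i <? depth (s i)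
... | yes i<d = subst (wt (s i) * 2 ^ suc (toℕ i) ≤_) (wt-depth (s i))
                      (*-monoʳ-≤ (wt (s i)) (^-monoʳ-≤ 2 i<d))
... | no _    = z≤n

-- Unless firefighter a stands at depth exactly a+1, the bound has room
-- for one more leaf: a useless firefighter saves nothing, and a deeper
-- useful one saves at most half of its allowance.
saved-slack : ∀ {h} (s : Strategy h h) a → depth (s a) ≢ suc (toℕ a) →
              suc (saved s a) * 2 ^ suc (toℕ a) ≤ 2 ^ h
saved-slack {h} s a d≢ with toℕ a <? depth (s a)
... | no _    = subst (_≤ 2 ^ h) (sym (+-identityʳ _)) (^-monoʳ-≤ 2 (toℕ<n a))
... | yes a<d = begin
  suc w * P           ≤⟨ *-monoˡ-≤ P (+-monoˡ-≤ w (wt-positive (s a))) ⟩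
  (w + w) * P         ≡⟨ cong (_* P) (sym (double w)) ⟩
  (2 * w) * P         ≡⟨ cong (_* P) (*-comm 2 w) ⟩
  (w * 2) * P         ≡⟨ *-assoc w 2 P ⟩
  w * 2 ^ suc (suc (toℕ a)) ≤⟨ *-monoʳ-≤ w (^-monoʳ-≤ 2 (≤∧≢⇒< a<d (λ e → d≢ (sym e)))) ⟩
  w * 2 ^ depth (s a) ≡⟨ wt-depth (s a) ⟩
  2 ^ h               ∎
  where
  open ≤-Reasoning
  w = wt (s a)
  P = 2 ^ suc (toℕ a)

-- Two firefighters on distinct vertices of the same depth cannot both stand
-- at depth exactly index+1, so one of them leaves slack.
same-depth-slack : ∀ {h} (s : Strategy h h) i j → s i ≢ s j → depth (s i) ≡ depth (s j) →
                   Σ (Fin h) λ a → suc (saved s a) * 2 ^ suc (toℕ a) ≤ 2 ^ h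
same-depth-slack s i j si≢sj di≡dj with depth (s i) ≟ suc (toℕ i)
... | no  di≢ = i , saved-slack s i di≢
... | yes di≡ = j , saved-slack s j λ dj≡ →
  si≢sj (cong s (toℕ-injective (suc-injective (trans (sym di≡) (trans di≡dj dj≡)))))

-- Two firefighters at one depth leave slack in Kraft's bound, so the useful
-- firefighters block weight at most 2^h - 2; two leaves escape them and burn.
mainTheorem6 : (h : ℕ) (s : Strategy h h) → Valid s →
    (Σ (Node h) λ u → Σ (Node h) λ v → u ≢ v × depth u ≡ depth v ×
    (Σ (Fin h) λ i → s i ≡ u) × (Σ (Fin h) λ j → s j ≡ v)) →
    Σ (Node h) λ a → Σ (Node h) λ b → a ≢ b × IsLeaf a × IsLeaf b ×
    Burnt s a × Burnt s b
mainTheorem6 h s _ (_ , _ , u≢v , du≡dv , (i , refl) , (j , refl))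
  with same-depth-slack s i j u≢v du≡dv
... | a , slack
  with two-free-leaves h (effective s)
         (subst (λ w → suc w < 2 ^ h) (sym (weight-effective s))
                (kraft-strict h (saved s) (saved-bound s) a slack))
... | ℓ₁ , ℓ₂ , ℓ₁≢ℓ₂ , leaf₁ , leaf₂ , free₁ , free₂ =
  ℓ₁ , ℓ₂ , ℓ₁≢ℓ₂ , leaf₁ , leaf₂ ,
  (depth ℓ₁ , burns-at-depth s _ ℓ₁ refl free₁) ,
  (depth ℓ₂ , burns-at-depth s _ ℓ₂ refl free₂)
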